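{- Let $G$ be a graph and let $k,k'$ be positive integers with $k'\leq k$. Suppose there are four vertices $x,y,u,v$ of $G$ such that $d_G(x,u)=d_G(x,v)=3k$, $d_G(u,v)=6k$ and $d_G(x,y)=3k+3k'$. Then $\mathrm{mp}(G)\geq 2k+k'$.
   Context: For a graph $G=(V,E)$, the ball of radius $r$ around $v$ is $N_r(v)=\{u\in V : d_G(u,v)\leq r\}$. A multipacking of $G$ is a set $P\subseteq V$ such that for every vertex $v$ and every positive integer $r$, $|N_r(v)\cap P|\leq r$. The multipacking number $\mathrm{mp}(G)$ is the maximum size of a multipacking of $G$. -}

module Defs where

open import Level using (0ℓ)
open import Data.Nat using (ℕ; zero; suc; _≤_; _<_)
open import Data.Fin using (Fin)
open import Data.List using (List; length)
open import Data.List.Membership.Propositional using (_∈_)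
open import Data.List.Relation.Binary.Subset.Propositional using (_⊆_)
open import Data.List.Relation.Unary.Unique.Propositional using (Unique)
open import Data.List.Relation.Unary.All using (All)
open import Data.Product using (_×_; ∃-syntax)
open import Relation.Nullary using (¬_)
open import Relation.Binary.PropositionalEquality using (_≡_)

record Graph : Set₁ where
  field
    order   : ℕ
    Adj     : Fin order → Fin order → Set
    sym     : ∀ {u v} → Adj u v → Adj v u
    irrefl  : ∀ {u} → ¬ Adj u u

module _ (G : Graph) where
  open Graph G

  Vertex : Set
  Vertex = Fin order

  -- Within G r u v : there is a walk from u to v with at most r edges,
  -- i.e. d_G(u,v) ≤ r.
  data Within : ℕ → Vertex → Vertex → Set where
    here : ∀ {r u} → Within r u u
    step : ∀ {r u w v} → Adj u w → Within r w v → Within (suc r) u v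

  Dist : Vertex → Vertex → ℕ → Set
  Dist u v m = Within m u v × (∀ r → r < m → ¬ Within r u v)

  InBall : ℕ → Vertex → Vertex → Set
  InBall r v u = Within r u v

  -- P (a duplicate-free list of vertices, i.e. a vertex set) is a multipacking:
  -- for every vertex v and r ≥ 1, |N_r(v) ∩ P| ≤ r, expressed as: every
  -- duplicate-free list of vertices contained in N_r(v) ∩ P has length ≤ r.
  IsMultipacking : List Vertex → Set
  IsMultipacking P =
    Unique P ×
    (∀ (v : Vertex) (r : ℕ) → 1 ≤ r →
       ∀ (Q : List Vertex) → Unique Q → Q ⊆ P → All (InBall r v) Q →
       length Q ≤ r)

  MpAtLeast : ℕ → Set
  MpAtLeast m = ∃[ P ] (IsMultipacking P × m ≤ length P)

module Submission where

-- Mark the vertices at distance 0, 3, …, 3k from x on a shortest x–u path, at distance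
-- 3, …, 3k on a shortest x–v path and at distance 3(k+1), …, 3(k+k′−1) on a shortest x–y
-- path: 2k+k′ vertices, the mark of level i lying at distance 3i from x.  As every mark lies
-- on a geodesic from x, marks at distance ≤ t have levels differing by at most t/3; as x
-- lies on a u–v geodesic, a u-side mark of level i and a v-side mark of level j are at
-- distance ≥ 3(i+j).  Hence the levels of the marks in a ball of radius r differ by at most
-- d = ⌊2r/3⌋ < r.  If the ball misses the u-side or the v-side, a mark is determined by its
-- level, so the ball holds at most d+1 ≤ r marks.  Otherwise its u- and v-side levels sum to
-- at most d, which leaves room in [0, r) for the y-side marks as long as r < 2k+k′ ≤ 3k;
-- a larger ball holds at most all 2k+k′ marks anyway.

open import Data.Nat using (ℕ; zero; suc; _≤_; _<_; _+_; _*_; _∸_; z≤n; s≤s; s≤s⁻¹; _≤?_)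
open import Data.Nat.Properties
open import Data.Nat.DivMod using (_/_; m*n/n≡m; /-monoˡ-≤; m/n*n≤m)
open import Data.Nat.Tactic.RingSolver using (solve-∀)
open import Data.List using (List; []; _∷_; _++_; length; map; applyUpTo)
open import Data.List.Properties using (length-map; length-++; length-applyUpTo; length-upTo; length-removeAt′)
open import Data.List.Membership.Propositional using (_∈_; _─_)
open import Data.List.Membership.Propositional.Properties using (∈-map⁻; ∈-upTo⁺; ∈-applyUpTo⁻; ∈-++⁻)
open import Data.List.Relation.Unary.Any using (here; there)
open import Data.List.Relation.Unary.All as All using (All; []; _∷_)
import Data.List.Relation.Unary.All.Properties as AllP
open import Data.List.Relation.Unary.AllPairs using ([]; _∷_)
open import Data.List.Relation.Unary.Unique.Propositional using (Unique)
open import Data.List.Relation.Unary.Unique.Propositional.Properties using (++⁺; map⁻; applyUpTo⁺₁)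
open import Data.List.Relation.Binary.Subset.Propositional using (_⊆_)
open import Data.List.Relation.Binary.Disjoint.Propositional using (Disjoint)
open import Data.Unit using (tt)
open import Function using (id)
open import Data.Product using (_×_; _,_; proj₁; proj₂; ∃-syntax)
open import Data.Sum using (_⊎_; inj₁; inj₂; [_,_]′)
open import Relation.Nullary using (¬_; yes; no; contradiction)
open import Level using (0ℓ)
open import Relation.Unary using (Pred; Decidable)
open import Relation.Binary.Definitions using (DecidableEquality)
open import Relation.Binary.PropositionalEquality
open import Defs

private
  variable
    A B : Set

∈-─⁺ : ∀ {x z : A} {ys : List A} (x∈ys : x ∈ ys) → z ∈ ys → z ≢ x → z ∈ ys ─ x∈ys
∈-─⁺ (here refl)  (here refl)  z≢x = contradiction refl z≢x
∈-─⁺ (here refl)  (there z∈ys) _   = z∈ys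
∈-─⁺ (there x∈ys) (here refl)  _   = here refl
∈-─⁺ (there x∈ys) (there z∈ys) z≢x = there (∈-─⁺ x∈ys z∈ys z≢x)

length≤-injection : ∀ {f : A → B} {xs ys} → Unique xs →
                    (∀ {x x′} → x ∈ xs → x′ ∈ xs → f x ≡ f x′ → x ≡ x′) →
                    (∀ {x} → x ∈ xs → f x ∈ ys) → length xs ≤ length ys
length≤-injection {xs = []} _ _ _ = z≤n
length≤-injection {f = f} {xs = x ∷ xs} {ys} (x∉xs ∷ uniq) inj into =
  subst (suc (length xs) ≤_) (sym (length-removeAt′ ys _))
    (s≤s (length≤-injection uniq (λ p q → inj (there p) (there q)) into′))
  where
  into′ : ∀ {z} → z ∈ xs → f z ∈ ys ─ into (here refl)
  into′ z∈xs = ∈-─⁺ (into (here refl)) (into (there z∈xs))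
                 (λ fz≡fx → All.lookup x∉xs z∈xs (sym (inj (there z∈xs) (here refl) fz≡fx)))

injection⇒length≤ : ∀ {f : A → ℕ} {xs n} → Unique xs →
                    (∀ {x x′} → x ∈ xs → x′ ∈ xs → f x ≡ f x′ → x ≡ x′) →
                    (∀ {x} → x ∈ xs → f x < n) → length xs ≤ n
injection⇒length≤ {n = n} uniq inj bound =
  subst (_ ≤_) (length-upTo n) (length≤-injection uniq inj (λ x∈xs → ∈-upTo⁺ (bound x∈xs)))

⊆-map⁻ : ∀ {f : A → B} {xs} (ys : List B) → (∀ {y} → y ∈ ys → y ∈ map f xs) →
         ∃[ zs ] (ys ≡ map f zs × All (_∈ xs) zs)
⊆-map⁻ [] _ = [] , refl , []
⊆-map⁻ (y ∷ ys) ys⊆ with ∈-map⁻ _ (ys⊆ (here refl)) | ⊆-map⁻ ys (λ y∈ys → ys⊆ (there y∈ys))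
... | z , z∈xs , refl | zs , refl , zs⊆xs = z ∷ zs , refl , z∈xs ∷ zs⊆xs

map⁺-injectiveOn : ∀ {f : A → B} {xs} → (∀ {x x′} → x ∈ xs → x′ ∈ xs → f x ≡ f x′ → x ≡ x′) →
                   Unique xs → Unique (map f xs)
map⁺-injectiveOn {xs = []}     _   []             = []
map⁺-injectiveOn {xs = x ∷ xs} inj (x∉xs ∷ uniq) =
  AllP.map⁺ (All.tabulate λ z∈xs fx≡fz → All.lookup x∉xs z∈xs (inj (here refl) (there z∈xs) fx≡fz))
  ∷ map⁺-injectiveOn (λ p q → inj (there p) (there q)) uniq

lowest-or-none : ∀ {P : Pred A 0ℓ} → Decidable P → (f : A → ℕ) (xs : List A) →
                 (∀ {x} → x ∈ xs → ¬ P x) ⊎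
                 ∃[ m ] (m ∈ xs × P m × ∀ {x} → x ∈ xs → P x → f m ≤ f x)
lowest-or-none P? f [] = inj₁ λ ()
lowest-or-none P? f (x ∷ xs) with P? x | lowest-or-none P? f xs
... | no ¬Px | inj₁ none =
  inj₁ λ { (here refl) → ¬Px ; (there x∈xs) → none x∈xs }
... | no ¬Px | inj₂ (m , m∈xs , Pm , least) =
  inj₂ (m , there m∈xs , Pm , λ { (here refl) Px → contradiction Px ¬Px ; (there z∈xs) → least z∈xs })
... | yes Px | inj₁ none =
  inj₂ (x , here refl , Px , λ { (here refl) _ → ≤-refl ; (there z∈xs) Pz → contradiction Pz (none z∈xs) })
... | yes Px | inj₂ (m , m∈xs , Pm , least) with f x ≤? f m
...   | yes fx≤fm = inj₂ (x , here refl , Px ,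
                         λ { (here refl) _ → ≤-refl ; (there z∈xs) Pz → ≤-trans fx≤fm (least z∈xs Pz) })
...   | no fx≰fm  = inj₂ (m , there m∈xs , Pm ,
                         λ { (here refl) _ → <⇒≤ (≰⇒> fx≰fm) ; (there z∈xs) → least z∈xs })

3*m≤n⇒m≤n/3 : ∀ {m n} → 3 * m ≤ n → m ≤ n / 3
3*m≤n⇒m≤n/3 {m} {n} 3m≤n = begin
  m         ≡⟨ m*n/n≡m m 3 ⟨
  m * 3 / 3 ≤⟨ /-monoˡ-≤ 3 (subst (_≤ n) (*-comm 3 m) 3m≤n) ⟩
  n / 3     ∎
  where open ≤-Reasoning

3*m≤3*n+o⇒m≤n+o/3 : ∀ {m n o} → 3 * m ≤ 3 * n + o → m ≤ n + o / 3
3*m≤3*n+o⇒m≤n+o/3 {m} {n} {o} le = begin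
  m           ≤⟨ m≤n+m∸n m n ⟩
  n + (m ∸ n) ≤⟨ +-monoʳ-≤ n (3*m≤n⇒m≤n/3 3[m∸n]≤o) ⟩
  n + o / 3   ∎
  where
  open ≤-Reasoning
  3[m∸n]≤o : 3 * (m ∸ n) ≤ o
  3[m∸n]≤o = subst (_≤ o) (sym (*-distribˡ-∸ 3 m n)) (m≤n+o⇒m∸n≤o (3 * m) (3 * n) le)

[r+r]/3<r : ∀ {r} → 0 < r → (r + r) / 3 < r
[r+r]/3<r {r} 0<r = *-cancelʳ-< 3 ((r + r) / 3) r (begin-strict
  (r + r) / 3 * 3 ≤⟨ m/n*n≤m (r + r) 3 ⟩
  r + r           <⟨ m<m+n (r + r) 0<r ⟩
  r + r + r       ≡⟨ triple r ⟩
  r * 3           ∎)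
  where
  open ≤-Reasoning
  triple : ∀ r → r + r + r ≡ r * 3
  triple = solve-∀

[r+r]/3+[r+r]/3<r+k : ∀ {r k} → r < 3 * k → (r + r) / 3 + (r + r) / 3 < r + k
[r+r]/3+[r+r]/3<r+k {r} {k} r<3k = *-cancelʳ-< 3 (d + d) (r + k) (begin-strict
  (d + d) * 3     ≡⟨ *-distribʳ-+ 3 d d ⟩
  d * 3 + d * 3   ≤⟨ +-mono-≤ (m/n*n≤m (r + r) 3) (m/n*n≤m (r + r) 3) ⟩
  (r + r) + (r + r) ≡⟨ regroup r ⟩
  r * 3 + r       <⟨ +-monoʳ-< (r * 3) r<3k ⟩
  r * 3 + 3 * k   ≡⟨ cong (r * 3 +_) (*-comm 3 k) ⟩
  r * 3 + k * 3   ≡⟨ *-distribʳ-+ 3 r k ⟨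
  (r + k) * 3     ∎)
  where
  open ≤-Reasoning
  d : ℕ
  d = (r + r) / 3
  regroup : ∀ r → (r + r) + (r + r) ≡ r * 3 + r
  regroup = solve-∀

module Walks (G : Graph) where
  open Graph G using () renaming (sym to Adj-sym)

  weaken : ∀ {m n a b} → m ≤ n → Within G m a b → Within G n a b
  weaken _         here          = here
  weaken (s≤s m≤n) (step adj w) = step adj (weaken m≤n w)

  _++ʷ_ : ∀ {m n a b c} → Within G m a b → Within G n b c → Within G (m + n) a c
  _++ʷ_ {m} {n} here w′ = weaken (m≤n+m n m) w′
  step adj w ++ʷ w′     = step adj (w ++ʷ w′)

  reverse : ∀ {n a b} → Within G n a b → Within G n b a
  reverse here = here
  reverse {suc n} (step adj w) =
    weaken (≤-reflexive (+-comm n 1)) (reverse w ++ʷ step (Adj-sym adj) (here {r = 0}))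

  vertexAt : ∀ {n a b} → Within G n a b → ℕ → Vertex G
  vertexAt {a = a} here         _       = a
  vertexAt {a = a} (step _ _)   zero    = a
  vertexAt         (step _ w)   (suc i) = vertexAt w i

  prefix : ∀ {n a b} (w : Within G n a b) i → Within G i a (vertexAt w i)
  prefix here         _       = here
  prefix (step _ _)   zero    = here
  prefix (step adj w) (suc i) = step adj (prefix w i)

  suffix : ∀ {n a b} (w : Within G n a b) i → Within G (n ∸ i) (vertexAt w i) b
  suffix here         _       = here
  suffix (step adj w) zero    = step adj w
  suffix (step _ w)   (suc i) = suffix w i

  Dist⇒≤ : ∀ {a b n t} → Dist G a b n → Within G t a b → n ≤ t
  Dist⇒≤ {n = n} {t} (_ , shorter) w with n ≤? t
  ... | yes n≤t = n≤t
  ... | no n≰t  = contradiction w (shorter t (≰⇒> n≰t))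

  geodesic-prefix : ∀ {a b n i s} (g : Dist G a b n) → i ≤ n →
                    Within G s a (vertexAt (proj₁ g) i) → i ≤ s
  geodesic-prefix {n = n} {i} {s} g i≤n w = +-cancelʳ-≤ (n ∸ i) i s (begin
    i + (n ∸ i) ≡⟨ m+[n∸m]≡n i≤n ⟩
    n           ≤⟨ Dist⇒≤ g (w ++ʷ suffix (proj₁ g) i) ⟩
    s + (n ∸ i) ∎)
    where open ≤-Reasoning

  opposite-geodesics : ∀ {x u v n n′ i j t} (g : Dist G x u n) (h : Dist G x v n′) →
                       Dist G u v (n + n′) → i ≤ n → j ≤ n′ →
                       Within G t (vertexAt (proj₁ g) i) (vertexAt (proj₁ h) j) → i + j ≤ t
  opposite-geodesics {u = u} {v} {n} {n′} {i} {j} {t} g h duv i≤n j≤n′ w =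
    +-cancelʳ-≤ ((n ∸ i) + (n′ ∸ j)) (i + j) t (begin
      (i + j) + ((n ∸ i) + (n′ ∸ j)) ≡⟨ interchange i j (n ∸ i) (n′ ∸ j) ⟩
      (i + (n ∸ i)) + (j + (n′ ∸ j)) ≡⟨ cong₂ _+_ (m+[n∸m]≡n i≤n) (m+[n∸m]≡n j≤n′) ⟩
      n + n′                         ≤⟨ Dist⇒≤ duv walk ⟩
      (n ∸ i) + t + (n′ ∸ j)         ≡⟨ rearrange (n ∸ i) t (n′ ∸ j) ⟩
      t + ((n ∸ i) + (n′ ∸ j))       ∎)
    where
    open ≤-Reasoning
    walk : Within G ((n ∸ i) + t + (n′ ∸ j)) u v
    walk = (reverse (suffix (proj₁ g) i) ++ʷ w) ++ʷ suffix (proj₁ h) j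
    interchange : ∀ a b c d → (a + b) + (c + d) ≡ (a + c) + (b + d)
    interchange = solve-∀
    rearrange : ∀ a b c → a + b + c ≡ b + (a + c)
    rearrange = solve-∀

data Branch : Set where
  U V Y : Branch

_≟ᵇ_ : DecidableEquality Branch
U ≟ᵇ U = yes refl
U ≟ᵇ V = no λ ()
U ≟ᵇ Y = no λ ()
V ≟ᵇ U = no λ ()
V ≟ᵇ V = yes refl
V ≟ᵇ Y = no λ ()
Y ≟ᵇ U = no λ ()
Y ≟ᵇ V = no λ ()
Y ≟ᵇ Y = yes refl

Mark : Set
Mark = Branch × ℕ

branch : Mark → Branch
branch = proj₁

level : Mark → ℕ
level = proj₂

Valid : ℕ → ℕ → Mark → Set
Valid k k′ (U , i) = i ≤ k
Valid k k′ (V , j) = 0 < j × j ≤ k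
Valid k k′ (Y , l) = k < l × l ≤ k + k′

data Opposite : Mark → Mark → Set where
  UV : ∀ {i j} → Opposite (U , i) (V , j)
  VU : ∀ {i j} → Opposite (V , i) (U , j)

same-level : ∀ {k k′} m m′ → Valid k k′ m → Valid k k′ m′ → level m ≡ level m′ →
             m ≡ m′ ⊎ Opposite m m′
same-level (U , i) (U , _) _ _ refl = inj₁ refl
same-level (V , j) (V , _) _ _ refl = inj₁ refl
same-level (Y , l) (Y , _) _ _ refl = inj₁ refl
same-level (U , _) (V , _) _ _ _    = inj₂ UV
same-level (V , _) (U , _) _ _ _    = inj₂ VU
same-level (U , i) (Y , _) i≤k (k<i , _) refl = contradiction i≤k (<⇒≱ k<i)
same-level (Y , l) (U , _) (k<l , _) l≤k refl = contradiction l≤k (<⇒≱ k<l)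
same-level (V , j) (Y , _) (_ , j≤k) (k<j , _) refl = contradiction j≤k (<⇒≱ k<j)
same-level (Y , l) (V , _) (k<l , _) (_ , l≤k) refl = contradiction l≤k (<⇒≱ k<l)

module Cluster {k k′ d r : ℕ} {ms : List Mark} (unique : Unique ms) (valid : All (Valid k k′) ms)
  (close : ∀ {m m′} → m ∈ ms → m′ ∈ ms → level m′ ≤ level m + d)
  (UV-close : ∀ {i j} → (U , i) ∈ ms → (V , j) ∈ ms → i + j ≤ d)
  (d<r : d < r) where

  length-bound-without-opposite : (∀ {m m′} → m ∈ ms → m′ ∈ ms → ¬ Opposite m m′) → length ms ≤ r
  length-bound-without-opposite no-opposite with lowest-or-none (λ _ → yes tt) level ms
  ... | inj₁ empty = injection⇒length≤ {f = level} unique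
                       (λ m∈ _ _ → contradiction tt (empty m∈)) (λ m∈ → contradiction tt (empty m∈))
  ... | inj₂ (m₀ , m₀∈ , _ , lowest-level) = injection⇒length≤ unique injective bounded
    where
    φ : Mark → ℕ
    φ m = level m ∸ level m₀

    above : ∀ {m} → m ∈ ms → level m₀ ≤ level m
    above m∈ = lowest-level m∈ tt

    injective : ∀ {m m′} → m ∈ ms → m′ ∈ ms → φ m ≡ φ m′ → m ≡ m′
    injective {m} {m′} m∈ m′∈ eq
      with same-level m m′ (All.lookup valid m∈) (All.lookup valid m′∈)
                      (∸-cancelʳ-≡ (above m∈) (above m′∈) eq)
    ... | inj₁ m≡m′ = m≡m′
    ... | inj₂ opp  = contradiction opp (no-opposite m∈ m′∈)

    bounded : ∀ {m} → m ∈ ms → φ m < r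
    bounded {m} m∈ = ≤-<-trans (m≤n+o⇒m∸n≤o (level m) (level m₀) (close m₀∈ m∈)) d<r

  module WithOpposite (d+d<r+k : d + d < r + k) {a₀ j₀ : ℕ} (a₀∈ : (U , a₀) ∈ ms) (j₀∈ : (V , j₀) ∈ ms)
           (a₀-lowest : ∀ {i} → (U , i) ∈ ms → a₀ ≤ i) where

    φ : Mark → ℕ
    φ (V , j) = j ∸ 1
    φ (U , i) = d ∸ i
    φ (Y , l) = d ∸ a₀ + (l ∸ k)

    V<U : ∀ {i j} → (U , i) ∈ ms → (V , j) ∈ ms → φ (V , j) < φ (U , i)
    V<U {i} {j} i∈ j∈ =
      ∸-monoˡ-< (s≤s (m+n≤o⇒m≤o∸n j (subst (_≤ d) (+-comm i j) (UV-close i∈ j∈))))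
                (proj₁ (All.lookup valid j∈))

    U<Y : ∀ {i l} → (U , i) ∈ ms → (Y , l) ∈ ms → φ (U , i) < φ (Y , l)
    U<Y {i} {l} i∈ l∈ = begin-strict
      d ∸ i              ≤⟨ ∸-monoʳ-≤ d (a₀-lowest i∈) ⟩
      d ∸ a₀             <⟨ m<m+n (d ∸ a₀) (m<n⇒0<n∸m (proj₁ (All.lookup valid l∈))) ⟩
      d ∸ a₀ + (l ∸ k)   ∎
      where open ≤-Reasoning

    V<Y : ∀ {j l} → (V , j) ∈ ms → (Y , l) ∈ ms → φ (V , j) < φ (Y , l)
    V<Y j∈ l∈ = <-trans (V<U a₀∈ j∈) (U<Y a₀∈ l∈)

    a₀≤d : a₀ ≤ d
    a₀≤d = m+n≤o⇒m≤o a₀ (UV-close a₀∈ j₀∈)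

    injective : ∀ {m m′} → m ∈ ms → m′ ∈ ms → φ m ≡ φ m′ → m ≡ m′
    injective {U , i} {U , i′} i∈ i′∈ eq =
      cong (U ,_) (∸-cancelˡ-≡ (m+n≤o⇒m≤o i (UV-close i∈ j₀∈)) (m+n≤o⇒m≤o i′ (UV-close i′∈ j₀∈)) eq)
    injective {V , j} {V , j′} j∈ j′∈ eq =
      cong (V ,_) (∸-cancelʳ-≡ (proj₁ (All.lookup valid j∈)) (proj₁ (All.lookup valid j′∈)) eq)
    injective {Y , l} {Y , l′} l∈ l′∈ eq =
      cong (Y ,_) (∸-cancelʳ-≡ (<⇒≤ (proj₁ (All.lookup valid l∈))) (<⇒≤ (proj₁ (All.lookup valid l′∈)))
                                (+-cancelˡ-≡ (d ∸ a₀) _ _ eq))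
    injective {U , _} {V , _} m∈ m′∈ eq = contradiction (sym eq) (<⇒≢ (V<U m∈ m′∈))
    injective {V , _} {U , _} m∈ m′∈ eq = contradiction eq (<⇒≢ (V<U m′∈ m∈))
    injective {U , _} {Y , _} m∈ m′∈ eq = contradiction eq (<⇒≢ (U<Y m∈ m′∈))
    injective {Y , _} {U , _} m∈ m′∈ eq = contradiction (sym eq) (<⇒≢ (U<Y m′∈ m∈))
    injective {V , _} {Y , _} m∈ m′∈ eq = contradiction eq (<⇒≢ (V<Y m∈ m′∈))
    injective {Y , _} {V , _} m∈ m′∈ eq = contradiction (sym eq) (<⇒≢ (V<Y m′∈ m∈))

    bounded : ∀ {m} → m ∈ ms → φ m < r
    bounded {U , i} _  = ≤-<-trans (m∸n≤m d i) d<r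
    bounded {V , j} j∈ = <-trans (V<U a₀∈ j∈) (bounded a₀∈)
    bounded {Y , l} l∈ = +-cancelʳ-< k (d ∸ a₀ + (l ∸ k)) r (begin-strict
      d ∸ a₀ + (l ∸ k) + k ≡⟨ +-assoc (d ∸ a₀) (l ∸ k) k ⟩
      d ∸ a₀ + (l ∸ k + k) ≡⟨ cong (d ∸ a₀ +_) (m∸n+n≡m (<⇒≤ (proj₁ (All.lookup valid l∈)))) ⟩
      d ∸ a₀ + l           ≤⟨ +-monoʳ-≤ (d ∸ a₀) (close a₀∈ l∈) ⟩
      d ∸ a₀ + (a₀ + d)    ≡⟨ +-assoc (d ∸ a₀) a₀ d ⟨
      d ∸ a₀ + a₀ + d      ≡⟨ cong (_+ d) (m∸n+n≡m a₀≤d) ⟩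
      d + d                <⟨ d+d<r+k ⟩
      r + k                ∎)
      where open ≤-Reasoning

    length-bound-with-opposite : length ms ≤ r
    length-bound-with-opposite = injection⇒length≤ unique injective bounded

  length-bound : d + d < r + k → length ms ≤ r
  length-bound d+d<r+k
    with lowest-or-none (λ m → branch m ≟ᵇ U) level ms | lowest-or-none (λ m → branch m ≟ᵇ V) level ms
  ... | inj₁ noU | _ =
    length-bound-without-opposite λ { m∈ _ UV → noU m∈ refl ; _ m′∈ VU → noU m′∈ refl }
  ... | inj₂ _ | inj₁ noV =
    length-bound-without-opposite λ { _ m′∈ UV → noV m′∈ refl ; m∈ _ VU → noV m∈ refl }
  ... | inj₂ ((U , a₀) , a₀∈ , refl , lowestU) | inj₂ ((V , j₀) , j₀∈ , refl , _) =
    WithOpposite.length-bound-with-opposite d+d<r+k a₀∈ j₀∈ (λ i∈ → lowestU i∈ refl)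

ray : Branch → ℕ → ℕ → List Mark
ray b from = applyUpTo (λ i → b , from + i)

∈-ray⁻ : ∀ {b from n m} → m ∈ ray b from n → branch m ≡ b × from ≤ level m × level m < from + n
∈-ray⁻ {from = from} m∈ with ∈-applyUpTo⁻ _ m∈
... | i , i<n , refl = refl , m≤m+n from i , +-monoʳ-< from i<n

ray-unique : ∀ b from n → Unique (ray b from n)
ray-unique b from n =
  applyUpTo⁺₁ _ n (λ i<j _ eq → <⇒≢ i<j (+-cancelˡ-≡ from _ _ (cong level eq)))

ray-disjoint : ∀ {b b′ from from′ n n′} → b ≢ b′ → Disjoint (ray b from n) (ray b′ from′ n′)
ray-disjoint b≢b′ (m∈ , m∈′) = b≢b′ (trans (sym (proj₁ (∈-ray⁻ m∈))) (proj₁ (∈-ray⁻ m∈′)))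

marks : ℕ → ℕ → List Mark
marks k k′ = ray U 0 (suc k) ++ ray V 1 k ++ ray Y (suc k) (k′ ∸ 1)

marks-unique : ∀ k k′ → Unique (marks k k′)
marks-unique k k′ =
  ++⁺ (ray-unique U 0 (suc k))
      (++⁺ (ray-unique V 1 k) (ray-unique Y (suc k) (k′ ∸ 1)) (ray-disjoint λ ()))
      (λ { (m∈ , m∈′) → [ (λ m∈V → ray-disjoint (λ ()) (m∈ , m∈V))
                          , (λ m∈Y → ray-disjoint (λ ()) (m∈ , m∈Y)) ]′ (∈-++⁻ (ray V 1 k) m∈′) })

marks-valid : ∀ {k k′ m} → m ∈ marks k k′ → Valid k k′ m
marks-valid {k} {k′} m∈ with ∈-++⁻ (ray U 0 (suc k)) m∈
... | inj₁ m∈U with ∈-ray⁻ m∈U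
...   | refl , _ , i<1+k = s≤s⁻¹ i<1+k
marks-valid {k} {k′} m∈ | inj₂ m∈VY with ∈-++⁻ (ray V 1 k) m∈VY
... | inj₁ m∈V with ∈-ray⁻ m∈V
...   | refl , 0<j , j<1+k = 0<j , s≤s⁻¹ j<1+k
marks-valid {k} {k′} m∈ | inj₂ m∈VY | inj₂ m∈Y with ∈-ray⁻ m∈Y
...   | refl , k<l , l<1+k+k′-1 = k<l , ≤-trans (s≤s⁻¹ l<1+k+k′-1) (+-monoʳ-≤ k (m∸n≤m k′ 1))

length-marks : ∀ k k′ → 0 < k′ → length (marks k k′) ≡ 2 * k + k′
length-marks k k′ 0<k′ = begin
  length (marks k k′)
    ≡⟨ length-++ (ray U 0 (suc k)) ⟩
  length (ray U 0 (suc k)) + length (ray V 1 k ++ ray Y (suc k) (k′ ∸ 1))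
    ≡⟨ cong₂ _+_ (length-applyUpTo (λ i → U , i) (suc k)) (length-++ (ray V 1 k)) ⟩
  suc k + (length (ray V 1 k) + length (ray Y (suc k) (k′ ∸ 1)))
    ≡⟨ cong (suc k +_) (cong₂ _+_ (length-applyUpTo (λ i → V , 1 + i) k)
                                 (length-applyUpTo (λ i → Y , suc k + i) (k′ ∸ 1))) ⟩
  suc k + (k + (k′ ∸ 1))
    ≡⟨ regroup k (k′ ∸ 1) ⟩
  2 * k + (1 + (k′ ∸ 1))
    ≡⟨ cong (2 * k +_) (m+[n∸m]≡n 0<k′) ⟩
  2 * k + k′ ∎
  where
  open ≡-Reasoning
  regroup : ∀ k n → suc k + (k + n) ≡ 2 * k + (1 + n)
  regroup = solve-∀

module Construction (G : Graph) {k k′ : ℕ} {x y u v : Vertex G}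
  (dxu : Dist G x u (3 * k)) (dxv : Dist G x v (3 * k)) (duv : Dist G u v (6 * k))
  (dxy : Dist G x y (3 * k + 3 * k′)) where
  open Walks G

  span : Branch → ℕ
  span U = 3 * k
  span V = 3 * k
  span Y = 3 * k + 3 * k′

  end : Branch → Vertex G
  end U = u
  end V = v
  end Y = y

  geodesic : ∀ b → Dist G x (end b) (span b)
  geodesic U = dxu
  geodesic V = dxv
  geodesic Y = dxy

  point : Mark → Vertex G
  point (b , i) = vertexAt (proj₁ (geodesic b)) (3 * i)

  valid⇒on-geodesic : ∀ {m} → Valid k k′ m → 3 * level m ≤ span (branch m)
  valid⇒on-geodesic {U , _} i≤k       = *-monoʳ-≤ 3 i≤k
  valid⇒on-geodesic {V , _} (_ , j≤k) = *-monoʳ-≤ 3 j≤k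
  valid⇒on-geodesic {Y , l} (_ , l≤k+k′) = subst (3 * l ≤_) (*-distribˡ-+ 3 k k′) (*-monoʳ-≤ 3 l≤k+k′)

  level-close : ∀ {m m′ t} → Valid k k′ m′ → Within G t (point m) (point m′) →
                3 * level m′ ≤ 3 * level m + t
  level-close {b , i} {b′ , _} valid w =
    geodesic-prefix (geodesic b′) (valid⇒on-geodesic valid) (prefix (proj₁ (geodesic b)) (3 * i) ++ʷ w)

  opposite-far : ∀ {i j t} → i ≤ k → j ≤ k → Within G t (point (U , i)) (point (V , j)) →
                 3 * i + 3 * j ≤ t
  opposite-far i≤k j≤k =
    opposite-geodesics dxu dxv (subst (Dist G u v) (six k) duv) (*-monoʳ-≤ 3 i≤k) (*-monoʳ-≤ 3 j≤k)
    where
    six : ∀ k → 6 * k ≡ 3 * k + 3 * k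
    six = solve-∀

  opposite-apart : ∀ {m m′} → Valid k k′ m → Valid k k′ m′ → Opposite m m′ →
                   ¬ Within G 0 (point m) (point m′)
  opposite-apart {U , i} {V , _} i≤k (0<j , j≤k) UV w =
    <⇒≱ (*-monoʳ-< 3 0<j) (m+n≤o⇒n≤o (3 * i) (opposite-far i≤k j≤k w))
  opposite-apart {V , _} {U , i} (0<j , j≤k) i≤k VU w =
    <⇒≱ (*-monoʳ-< 3 0<j) (m+n≤o⇒n≤o (3 * i) (opposite-far i≤k j≤k (reverse w)))

  point-injective : ∀ {m m′} → Valid k k′ m → Valid k k′ m′ → point m ≡ point m′ → m ≡ m′
  point-injective {m} {m′} valid valid′ eq =
    [ id , (λ opp → contradiction w (opposite-apart valid valid′ opp)) ]′
      (same-level m m′ valid valid′ (≤-antisym (lower (level-close {m′} {m} valid (reverse w)))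
                                               (lower (level-close {m} {m′} valid′ w))))
    where
    w : Within G 0 (point m) (point m′)
    w = subst (Within G 0 (point m)) eq here
    lower : ∀ {a b} → 3 * a ≤ 3 * b + 0 → a ≤ b
    lower {a} {b} le = *-cancelˡ-≤ 3 (subst (3 * a ≤_) (+-identityʳ (3 * b)) le)

  few-in-small-ball : ∀ {w r ms} → 0 < r → r < 3 * k → Unique ms → All (Valid k k′) ms →
                      All (λ m → Within G r (point m) w) ms → length ms ≤ r
  few-in-small-ball {w} {r} {ms} 0<r r<3k unique valid near =
    Cluster.length-bound unique valid close UV-close ([r+r]/3<r 0<r) ([r+r]/3+[r+r]/3<r+k r<3k)
    where
    walk : ∀ {m m′} → m ∈ ms → m′ ∈ ms → Within G (r + r) (point m) (point m′)
    walk m∈ m′∈ = All.lookup near m∈ ++ʷ reverse (All.lookup near m′∈)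

    close : ∀ {m m′} → m ∈ ms → m′ ∈ ms → level m′ ≤ level m + (r + r) / 3
    close {m} {m′} m∈ m′∈ =
      3*m≤3*n+o⇒m≤n+o/3 {n = level m} (level-close {m} {m′} (All.lookup valid m′∈) (walk m∈ m′∈))

    UV-close : ∀ {i j} → (U , i) ∈ ms → (V , j) ∈ ms → i + j ≤ (r + r) / 3
    UV-close {i} {j} i∈ j∈ = 3*m≤n⇒m≤n/3 (subst (_≤ r + r) (sym (*-distribˡ-+ 3 i j))
      (opposite-far (All.lookup valid i∈) (proj₂ (All.lookup valid j∈)) (walk i∈ j∈)))

  multipacking : 0 < k′ → k′ ≤ k → IsMultipacking G (map point (marks k k′))
  multipacking 0<k′ k′≤k = unique , ball-bound
    where
    unique : Unique (map point (marks k k′))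
    unique = map⁺-injectiveOn (λ m∈ m′∈ → point-injective (marks-valid m∈) (marks-valid m′∈))
                              (marks-unique k k′)

    ball-bound : ∀ w r → 1 ≤ r → ∀ Q → Unique Q → Q ⊆ map point (marks k k′) →
                 All (InBall G r w) Q → length Q ≤ r
    ball-bound w r 0<r Q Q-unique Q⊆P Q-near with 2 * k + k′ ≤? r
    ... | yes |P|≤r = begin
      length Q                        ≤⟨ length≤-injection {f = id} Q-unique (λ _ _ eq → eq) Q⊆P ⟩
      length (map point (marks k k′)) ≡⟨ length-map point (marks k k′) ⟩
      length (marks k k′)             ≡⟨ length-marks k k′ 0<k′ ⟩
      2 * k + k′                      ≤⟨ |P|≤r ⟩
      r                               ∎
      where open ≤-Reasoning
    ... | no |P|≰r with ⊆-map⁻ Q Q⊆P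
    ...   | ms , refl , ms⊆marks =
      subst (_≤ r) (sym (length-map point ms))
        (few-in-small-ball 0<r r<3k (map⁻ Q-unique) (All.map marks-valid ms⊆marks) (AllP.map⁻ Q-near))
      where
      r<3k : r < 3 * k
      r<3k = <-≤-trans (≰⇒> |P|≰r) (subst (2 * k + k′ ≤_) (two+one k) (+-monoʳ-≤ (2 * k) k′≤k))
        where
        two+one : ∀ k → 2 * k + k ≡ 3 * k
        two+one = solve-∀

theorem5 : (G : Graph) (k k′ : ℕ) → 1 ≤ k → 1 ≤ k′ → k′ ≤ k →
    (x y u v : Vertex G) →
    Dist G x u (3 * k) → Dist G x v (3 * k) → Dist G u v (6 * k) →
    Dist G x y (3 * k + 3 * k′) →
    MpAtLeast G (2 * k + k′)
-- 1 ≤ k follows from 1 ≤ k′ ≤ k.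
theorem5 G k k′ _ 0<k′ k′≤k x y u v dxu dxv duv dxy =
  map point (marks k k′) , multipacking 0<k′ k′≤k ,
  ≤-reflexive (sym (trans (length-map point (marks k k′)) (length-marks k k′ 0<k′)))
  where open Construction G {k} {k′} dxu dxv duv dxy
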